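{- Fix a meet constraint structure $(\Psi_d)_d$, a compatibility relation $\epsilon$ satisfying axioms (Proj) and (Meet), a witness builder $\sigma\mapsto W_\sigma$ satisfying (Witness), a ground validity predicate $\models$, and a constraint-producing predicate $(\models^d)_d$ satisfying (Rel). Let $d$ be a domain and $\Gamma$ a context of domain $d$. Then: (1) If $\vdash^{d}\Gamma\to\sigma$ is derivable in DI, then for every $\rho\in\mathrm{Inst}_d$ with $\rho\,\epsilon\,\sigma$, the sequent $\vdash\rho(\Gamma)$ is derivable in LK1. (2) For every $\rho\in\mathrm{Inst}_d$, if $\vdash\rho(\Gamma)$ is derivable in LK1, then there exists $\sigma\in\Psi_d$ such that $\vdash^{d}\Gamma\to\sigma$ is derivable in DI and $\rho\,\epsilon\,\sigma$.
   Context: Formulae are first-order formulae in negation normal form, built from literals with $\wedge,\vee,\forall,\exists$. Besides bound variables there are eigenvariables ($\bar x,\dots$) and meta-variables ($X,\dots$). Domains: there is an initial domain $d_0$; for a domain $d$ and an eigenvariable $\bar x$ (resp. meta-variable $X$) not declared in $d$, $d;\bar x$ (resp. $d;X$) is the domain extending $d$ with that declaration. A term (formula) of domain $d$ is one whose variables (free variables) are eigenvariables or meta-variables declared in $d$; it is ground if it contains no meta-variable. $T_d$ is the set of ground terms of domain $d$. A context of domain $d$ is a multiset of formulae of domain $d$; $\Gamma_{lit}$ is the set of literals of $\Gamma$. Instantiations: $\mathrm{Inst}_{d_0}=\{\emptyset\}$, $\mathrm{Inst}_{d;\bar x}=\mathrm{Inst}_d$, $\mathrm{Inst}_{d;X}=\{\rho\cup\{X\mapsto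 t\}\mid t\in T_d,\rho\in\mathrm{Inst}_d\}$; $\rho(\Gamma)$ substitutes each meta-variable of $d$ by its image under $\rho$. A ground validity predicate $\models$ is a predicate on sets of ground literals. LK1 derives sequents $\vdash\Gamma$ ($\Gamma$ a set of formulae) by the rules: $\vdash\Gamma$ holds if $\models\Gamma_{lit}$; from $\vdash\Gamma,A$ and $\vdash\Gamma,B$ infer $\vdash\Gamma,A\wedge B$; from $\vdash\Gamma,A,B$ infer $\vdash\Gamma,A\vee B$; from $\vdash\Gamma,A[x:=t],\exists xA$ infer $\vdash\Gamma,\exists xA$ (any term $t$); from $\vdash\Gamma,A[x:=\bar x]$ infer $\vdash\Gamma,\forall xA$ with $\bar x$ a fresh eigenvariable. A constraint structure is a family of sets $(\Psi_d)_d$ with $\Psi_{d;\bar x}=\Psi_d$, with projection maps $\Psi_{d;X}\to\Psi_d$, $\sigma\mapsto\sigma{\downarrow}$; it is a meet constraint structure if each $\Psi_d$ has a binary operation $\wedge$. A compatibility relation is a family of relations $\rho\,\epsilon\,\sigma$ between $\rho\in\mathrm{Inst}_d$ and $\sigma\in\Psi_d$. Axioms: (Proj) for $\sigma\in\Psi_{d;X}$, $t\in T_d$, $\rho\in\mathrm{Inst}_d$: $(\rho\cup\{X\mapsto t\})\,\epsilon\,\sigma\Rightarrow\rho\,\epsilon\,\sigma{\downarrow}$. (Meet) for $\sigma,\sigma'\in\Psi_d$, $\rho\in\mathrm{Inst}_d$: ($\rho\,\epsilon\,\sigma$ and $\rho\,\epsilon\,\sigma'$) iff $\rho\,\epsilon\,(\sigma\wedge\sigma')$.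 A witness builder maps each $\sigma\in\Psi_{d;X}$ to a function $W_\sigma:\mathrm{Inst}_d\to T_d$, satisfying (Witness): $\rho\,\epsilon\,\sigma{\downarrow}\Rightarrow(\rho\cup\{X\mapsto W_\sigma(\rho)\})\,\epsilon\,\sigma$. A constraint-producing predicate is a family of relations $\mathcal A\models^d\sigma$ between sets $\mathcal A$ of literals of domain $d$ and $\sigma\in\Psi_d$. (Rel): for all $d$ and $\mathcal A$, $\{\rho\in\mathrm{Inst}_d\mid\ \models\rho(\mathcal A)\}=\bigcup_{\sigma:\mathcal A\models^d\sigma}\{\rho\mid\rho\,\epsilon\,\sigma\}$. System DI derives sequents $\vdash^d\Gamma\to\sigma$ ($\Gamma$, $\sigma$ of domain $d$) by: $\vdash^d\Gamma\to\sigma$ if $\Gamma_{lit}\models^d\sigma$; from $\vdash^d\Gamma,A\to\sigma$ and $\vdash^d\Gamma,B\to\sigma'$ infer $\vdash^d\Gamma,A\wedge B\to\sigma\wedge\sigma'$; from $\vdash^d\Gamma,A,B\to\sigma$ infer $\vdash^d\Gamma,A\vee B\to\sigma$; from $\vdash^{d;X}\Gamma,A[x:=X],\exists xA\to\sigma$ infer $\vdash^d\Gamma,\exists xA\to\sigma{\downarrow}$ ($X$ fresh meta-variable); from $\vdash^{d;\bar x}\Gamma,A[x:=\bar x]\to\sigma$ infer $\vdash^d\Gamma,\forall xA\to\sigma$ ($\bar x$ fresh eigenvariable). -}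

module Defs where

open import Data.Nat using (ℕ; zero; suc)
open import Data.Fin using (Fin; zero; suc)
open import Data.List using (List; []; _∷_; _++_; map; concat)
open import Data.Maybe using (Maybe; just; nothing)
open import Data.Empty using (⊥)
open import Data.Unit using (⊤; tt)
open import Data.Product using (Σ; _×_; _,_; proj₁)
open import Data.List.Membership.Propositional using (_∈_; _∉_)
open import Data.List.Relation.Unary.All using (All)
open import Data.List.Relation.Binary.Permutation.Propositional using (_↭_)
open import Data.List.Relation.Binary.BagAndSetEquality using (_∼[_]_; set)
open import Function.Bundles using (_⇔_)

-- Eigenvariables are global names; bound variables are de Bruijn
-- indices (Fin n); meta-variables of a domain d are the elements of MV d
-- (the meta-variable declarations of d).
Name : Set
Name = ℕ

data Decl : Set where
  eig  : Name → Decl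
  meta : Decl

-- A domain is the list of its declarations, most recent first:
-- d;x̄ is  eig x ∷ d  and  d;X  is  meta ∷ d.
Dom : Set
Dom = List Decl

d₀ : Dom
d₀ = []

data WfDom : Dom → Set where
  wf₀    : WfDom d₀
  wf-eig : ∀ {d} x → eig x ∉ d → WfDom d → WfDom (eig x ∷ d)
  wf-meta : ∀ {d} → WfDom d → WfDom (meta ∷ d)

Declared : Name → Dom → Set
Declared x d = eig x ∈ d

MV : Dom → Set
MV [] = ⊥
MV (eig _ ∷ d) = MV d
MV (meta ∷ d) = Maybe (MV d)     -- nothing = the newly declared X

-- removes the trailing (most recent) eigenvariable declarations;
-- used to make Ψ_{d;x̄} = Ψ_d hold definitionally
strip : Dom → Dom
strip [] = []
strip (eig _ ∷ d) = strip d
strip (meta ∷ d) = meta ∷ d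

data Term (F M : Set) (n : ℕ) : Set where
  bv : Fin n → Term F M n
  ev : Name → Term F M n
  mv : M → Term F M n
  fn : F → List (Term F M n) → Term F M n

data Lit (F P M : Set) (n : ℕ) : Set where
  pos : P → List (Term F M n) → Lit F P M n
  neg : P → List (Term F M n) → Lit F P M n

data Formula (F P M : Set) (n : ℕ) : Set where
  atom  : Lit F P M n → Formula F P M n
  _∧ᶠ_ : Formula F P M n → Formula F P M n → Formula F P M n
  _∨ᶠ_ : Formula F P M n → Formula F P M n → Formula F P M n
  ∀ᶠ    : Formula F P M (suc n) → Formula F P M n
  ∃ᶠ    : Formula F P M (suc n) → Formula F P M n

module _ {F : Set} where

  renT  : ∀ {M n m} → (Fin n → Fin m) → Term F M n → Term F M m
  renTs : ∀ {M n m} → (Fin n → Fin m) → List (Term F M n) → List (Term F M m)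
  renT r (bv i) = bv (r i)
  renT r (ev x) = ev x
  renT r (mv X) = mv X
  renT r (fn f ts) = fn f (renTs r ts)
  renTs r [] = []
  renTs r (t ∷ ts) = renT r t ∷ renTs r ts

  subT  : ∀ {M n m} → (Fin n → Term F M m) → Term F M n → Term F M m
  subTs : ∀ {M n m} → (Fin n → Term F M m) → List (Term F M n) → List (Term F M m)
  subT s (bv i) = s i
  subT s (ev x) = ev x
  subT s (mv X) = mv X
  subT s (fn f ts) = fn f (subTs s ts)
  subTs s [] = []
  subTs s (t ∷ ts) = subT s t ∷ subTs s ts

  msubT  : ∀ {M M' n} → (M → Term F M' 0) → Term F M n → Term F M' n
  msubTs : ∀ {M M' n} → (M → Term F M' 0) → List (Term F M n) → List (Term F M' n)
  msubT s (bv i) = bv i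
  msubT s (ev x) = ev x
  msubT s (mv X) = renT (λ ()) (s X)
  msubT s (fn f ts) = fn f (msubTs s ts)
  msubTs s [] = []
  msubTs s (t ∷ ts) = msubT s t ∷ msubTs s ts

  eigsT  : ∀ {M n} → Term F M n → List Name
  eigsTs : ∀ {M n} → List (Term F M n) → List Name
  eigsT (bv i) = []
  eigsT (ev x) = x ∷ []
  eigsT (mv X) = []
  eigsT (fn f ts) = eigsTs ts
  eigsTs [] = []
  eigsTs (t ∷ ts) = eigsT t ++ eigsTs ts

  lift : ∀ {M n m} → (Fin n → Term F M m) → Fin (suc n) → Term F M (suc m)
  lift s zero = bv zero
  lift s (suc i) = renT suc (s i)

module _ {F P : Set} where

  subL : ∀ {M n m} → (Fin n → Term F M m) → Lit F P M n → Lit F P M m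
  subL s (pos p ts) = pos p (subTs s ts)
  subL s (neg p ts) = neg p (subTs s ts)

  subF : ∀ {M n m} → (Fin n → Term F M m) → Formula F P M n → Formula F P M m
  subF s (atom l) = atom (subL s l)
  subF s (A ∧ᶠ B) = subF s A ∧ᶠ subF s B
  subF s (A ∨ᶠ B) = subF s A ∨ᶠ subF s B
  subF s (∀ᶠ A) = ∀ᶠ (subF (lift s) A)
  subF s (∃ᶠ A) = ∃ᶠ (subF (lift s) A)

  -- A[x:=t], x the outermost bound variable (de Bruijn index 0)
  _[_] : ∀ {M n} → Formula F P M (suc n) → Term F M n → Formula F P M n
  A [ t ] = subF (λ { zero → t ; (suc i) → bv i }) A

  msubL : ∀ {M M' n} → (M → Term F M' 0) → Lit F P M n → Lit F P M' n
  msubL s (pos p ts) = pos p (msubTs s ts)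
  msubL s (neg p ts) = neg p (msubTs s ts)

  msubF : ∀ {M M' n} → (M → Term F M' 0) → Formula F P M n → Formula F P M' n
  msubF s (atom l) = atom (msubL s l)
  msubF s (A ∧ᶠ B) = msubF s A ∧ᶠ msubF s B
  msubF s (A ∨ᶠ B) = msubF s A ∨ᶠ msubF s B
  msubF s (∀ᶠ A) = ∀ᶠ (msubF s A)
  msubF s (∃ᶠ A) = ∃ᶠ (msubF s A)

  eigsL : ∀ {M n} → Lit F P M n → List Name
  eigsL (pos p ts) = eigsTs ts
  eigsL (neg p ts) = eigsTs ts

  eigsF : ∀ {M n} → Formula F P M n → List Name
  eigsF (atom l) = eigsL l
  eigsF (A ∧ᶠ B) = eigsF A ++ eigsF B
  eigsF (A ∨ᶠ B) = eigsF A ++ eigsF B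
  eigsF (∀ᶠ A) = eigsF A
  eigsF (∃ᶠ A) = eigsF A

  lits : ∀ {M n} → List (Formula F P M n) → List (Lit F P M n)
  lits [] = []
  lits (atom l ∷ Γ) = l ∷ lits Γ
  lits (_ ∷ Γ) = lits Γ

  -- scoping: a literal / formula of domain d (all its eigenvariables are
  -- declared in d; its meta-variables are in MV d by typing)
  LitOfDom : (d : Dom) → Lit F P (MV d) 0 → Set
  LitOfDom d l = All (λ x → Declared x d) (eigsL l)

  FormOfDom : (d : Dom) → Formula F P (MV d) 0 → Set
  FormOfDom d A = All (λ x → Declared x d) (eigsF A)

GTerm : (F : Set) → Dom → Set
GTerm F d = Σ (Term F ⊥ 0) λ t → All (λ x → Declared x d) (eigsT t)

-- Inst_d ;  an element of Inst_(d;X) is a pair (ρ , t) standing for ρ ∪ {X ↦ t}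
Inst : (F : Set) → Dom → Set
Inst F [] = ⊤
Inst F (eig _ ∷ d) = Inst F d
Inst F (meta ∷ d) = Inst F d × GTerm F d

lookupI : ∀ {F} (d : Dom) → Inst F d → MV d → Term F ⊥ 0
lookupI [] _ ()
lookupI (eig _ ∷ d) ρ X = lookupI d ρ X
lookupI (meta ∷ d) (ρ , t) nothing = proj₁ t
lookupI (meta ∷ d) (ρ , t) (just X) = lookupI d ρ X

toStrip : ∀ {F} (d : Dom) → Inst F d → Inst F (strip d)
toStrip [] ρ = ρ
toStrip (eig _ ∷ d) ρ = toStrip d ρ
toStrip (meta ∷ d) ρ = ρ

instL : ∀ {F P} (d : Dom) → Inst F d → Lit F P (MV d) 0 → Lit F P ⊥ 0
instL d ρ = msubL (lookupI d ρ)

instF : ∀ {F P} (d : Dom) → Inst F d → Formula F P (MV d) 0 → Formula F P ⊥ 0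
instF d ρ = msubF (lookupI d ρ)

-- the compatibility relation at domain d, obtained from a relation on
-- "stripped" domains so that ε_(d;x̄) = ε_d
Compat : (F : Set) (Ψ' : Dom → Set) → ((d : Dom) → Inst F d → Ψ' d → Set) →
         (d : Dom) → Inst F d → Ψ' (strip d) → Set
Compat F Ψ' ε' d ρ σ = ε' (strip d) (toStrip d ρ) σ

record Setup : Set₁ where
  field
    Fun Pred : Set
    -- meet constraint structure: Ψ_d := Ψ' (strip d), so Ψ_(d;x̄) = Ψ_d
    Ψ'   : Dom → Set
    proj : (d : Dom) → Ψ' (meta ∷ d) → Ψ' (strip d)
    meet : (d : Dom) → Ψ' (strip d) → Ψ' (strip d) → Ψ' (strip d)
    ε'   : (d : Dom) → Inst Fun d → Ψ' d → Set
    W    : (d : Dom) → Ψ' (meta ∷ d) → Inst Fun d → GTerm Fun d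
    -- ground validity predicate (a predicate on SETS of ground literals)
    ⊨    : List (Lit Fun Pred ⊥ 0) → Set
    ⊨-set : ∀ {𝒜 ℬ} → 𝒜 ∼[ set ] ℬ → ⊨ 𝒜 → ⊨ ℬ
    -- constraint-producing predicate (relation on SETS of literals × Ψ_d)
    ⊨[_] : (d : Dom) → List (Lit Fun Pred (MV d) 0) → Ψ' (strip d) → Set
    ⊨[]-set : ∀ {d 𝒜 ℬ σ} → 𝒜 ∼[ set ] ℬ → ⊨[ d ] 𝒜 σ → ⊨[ d ] ℬ σ
    ax-Proj : ∀ d (σ : Ψ' (meta ∷ d)) (t : GTerm Fun d) (ρ : Inst Fun d) →
              Compat Fun Ψ' ε' (meta ∷ d) (ρ , t) σ →
              Compat Fun Ψ' ε' d ρ (proj d σ)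
    ax-Meet : ∀ d (σ σ' : Ψ' (strip d)) (ρ : Inst Fun d) →
              (Compat Fun Ψ' ε' d ρ σ × Compat Fun Ψ' ε' d ρ σ')
                ⇔ Compat Fun Ψ' ε' d ρ (meet d σ σ')
    ax-Witness : ∀ d (σ : Ψ' (meta ∷ d)) (ρ : Inst Fun d) →
                 Compat Fun Ψ' ε' d ρ (proj d σ) →
                 Compat Fun Ψ' ε' (meta ∷ d) (ρ , W d σ ρ) σ
    ax-Rel : ∀ d (𝒜 : List (Lit Fun Pred (MV d) 0)) →
             All (LitOfDom d) 𝒜 → ∀ (ρ : Inst Fun d) →
             ⊨ (map (instL d ρ) 𝒜)
               ⇔ Σ (Ψ' (strip d)) (λ σ → ⊨[ d ] 𝒜 σ × Compat Fun Ψ' ε' d ρ σ)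

module Systems (S : Setup) where
  open Setup S

  Ψ : Dom → Set
  Ψ d = Ψ' (strip d)

  Inst' : Dom → Set
  Inst' d = Inst Fun d

  ε : (d : Dom) → Inst Fun d → Ψ d → Set
  ε d ρ σ = Compat Fun Ψ' ε' d ρ σ

  GForm : Set
  GForm = Formula Fun Pred ⊥ 0

  Form : Dom → Set
  Form d = Formula Fun Pred (MV d) 0

  -- LK1: sequents ⊢ Γ over ground formulae of domain d (the domain
  -- records the eigenvariables introduced so far, for freshness and for
  -- the terms allowed in the ∃-rule); Γ is taken up to permutation.
  data LK1 (d : Dom) : List GForm → Set where
    lk-ax : ∀ {Γ} → ⊨ (lits Γ) → LK1 d Γ
    lk-∧  : ∀ {Γ Δ A B} → Γ ↭ (A ∧ᶠ B) ∷ Δ →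
            LK1 d (A ∷ Δ) → LK1 d (B ∷ Δ) → LK1 d Γ
    lk-∨  : ∀ {Γ Δ A B} → Γ ↭ (A ∨ᶠ B) ∷ Δ →
            LK1 d (A ∷ B ∷ Δ) → LK1 d Γ
    lk-∃  : ∀ {Γ Δ A} → Γ ↭ ∃ᶠ A ∷ Δ → (t : GTerm Fun d) →
            LK1 d (A [ proj₁ t ] ∷ ∃ᶠ A ∷ Δ) → LK1 d Γ
    lk-∀  : ∀ {Γ Δ A} → Γ ↭ ∀ᶠ A ∷ Δ → (x : Name) → eig x ∉ d →
            LK1 (eig x ∷ d) (A [ ev x ] ∷ Δ) → LK1 d Γ

  wkM : ∀ {n} (d : Dom) → Formula Fun Pred (MV d) n → Formula Fun Pred (MV (meta ∷ d)) n
  wkM d = msubF (λ X → mv (just X))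

  -- DI: sequents ⊢^d Γ → σ, Γ a context (multiset, list up to permutation)
  data DI : (d : Dom) → List (Form d) → Ψ d → Set where
    di-ax : ∀ {d Γ σ} → ⊨[ d ] (lits Γ) σ → DI d Γ σ
    di-∧  : ∀ {d Γ Δ A B σ σ'} → Γ ↭ (A ∧ᶠ B) ∷ Δ →
            DI d (A ∷ Δ) σ → DI d (B ∷ Δ) σ' → DI d Γ (meet d σ σ')
    di-∨  : ∀ {d Γ Δ A B σ} → Γ ↭ (A ∨ᶠ B) ∷ Δ →
            DI d (A ∷ B ∷ Δ) σ → DI d Γ σ
    di-∃  : ∀ {d Γ Δ A σ} → Γ ↭ ∃ᶠ A ∷ Δ →
            DI (meta ∷ d) ((wkM d A [ mv nothing ]) ∷ wkM d (∃ᶠ A) ∷ map (wkM d) Δ) σ →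
            DI d Γ (proj d σ)
    di-∀  : ∀ {d Γ Δ A σ} → Γ ↭ ∀ᶠ A ∷ Δ → (x : Name) → eig x ∉ d →
            DI (eig x ∷ d) (A [ ev x ] ∷ Δ) σ → DI d Γ σ

module Submission where

--  * Soundness (DI ⇒ LK1): axioms use (Rel), ∧-rules use (Meet), and an
--    ∃-rule instantiates its fresh meta-variable X by the witness W_σ(ρ).
--  * Completeness (LK1 ⇒ DI): the principal formula of the last LK1 rule is
--    located in ρ(Γ) and lifted to a formula of Γ with the same connective;
--    axioms use (Rel), ∧-rules (Meet), and an ∃-rule with term t continues at
--    domain d;X with ρ ∪ {X ↦ t}, projecting back by (Proj).
--
-- Since LK1 derivations
-- depend only on the eigenvariables of their domain, DI premises of domain
-- d;X can be read as LK1 sequents of domain d.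

open import Defs
import Data.Nat as ℕ
open import Data.Fin using (Fin; zero; suc)
open import Data.List using (List; []; _∷_; _++_; map)
open import Data.Maybe using (just; nothing)
open import Data.Product using (Σ; _×_; _,_; proj₁; proj₂)
open import Data.List.Relation.Unary.All as All using (All; []; _∷_)
open import Data.List.Relation.Unary.All.Properties using (++⁺; ++⁻)
import Data.List.Relation.Unary.All.Properties as All
open import Data.List.Relation.Unary.Any using (here; there)
open import Data.List.Membership.Propositional using (_∈_)
open import Data.List.Membership.Propositional.Properties using (∈-map⁻; ∈-∃++)
open import Data.List.Relation.Binary.Permutation.Propositional
  using (_↭_; prep; ↭-refl; ↭-sym; ↭-trans; ↭-reflexive)
open import Data.List.Relation.Binary.Permutation.Propositional.Properties
  using (∈-resp-↭; map⁺; shift; drop-∷; All-resp-↭)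
open import Data.List.Relation.Binary.BagAndSetEquality using (_∼[_]_; set)
open import Function.Bundles using (Equivalence; mk⇔)
open import Relation.Binary.PropositionalEquality
  using (_≡_; refl; sym; cong; cong₂; subst) renaming (trans to ≡-trans)

module _ {F : Set} where

  renT-closed : ∀ {M n m} (r : Fin 0 → Fin n) (r' : Fin 0 → Fin m) (r₂ : Fin n → Fin m)
                (c : Term F M 0) → renT r₂ (renT r c) ≡ renT r' c
  renTs-closed : ∀ {M n m} (r : Fin 0 → Fin n) (r' : Fin 0 → Fin m) (r₂ : Fin n → Fin m)
                 (cs : List (Term F M 0)) → renTs r₂ (renTs r cs) ≡ renTs r' cs
  renT-closed r r' r₂ (bv ())
  renT-closed r r' r₂ (ev x) = refl
  renT-closed r r' r₂ (mv X) = refl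
  renT-closed r r' r₂ (fn f ts) = cong (fn f) (renTs-closed r r' r₂ ts)
  renTs-closed r r' r₂ [] = refl
  renTs-closed r r' r₂ (t ∷ ts) = cong₂ _∷_ (renT-closed r r' r₂ t) (renTs-closed r r' r₂ ts)

  subT-closed : ∀ {M n m} (r : Fin 0 → Fin n) (r' : Fin 0 → Fin m) (τ : Fin n → Term F M m)
                (c : Term F M 0) → subT τ (renT r c) ≡ renT r' c
  subTs-closed : ∀ {M n m} (r : Fin 0 → Fin n) (r' : Fin 0 → Fin m) (τ : Fin n → Term F M m)
                 (cs : List (Term F M 0)) → subTs τ (renTs r cs) ≡ renTs r' cs
  subT-closed r r' τ (bv ())
  subT-closed r r' τ (ev x) = refl
  subT-closed r r' τ (mv X) = refl
  subT-closed r r' τ (fn f ts) = cong (fn f) (subTs-closed r r' τ ts)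
  subTs-closed r r' τ [] = refl
  subTs-closed r r' τ (t ∷ ts) = cong₂ _∷_ (subT-closed r r' τ t) (subTs-closed r r' τ ts)

  renT-closed-id : ∀ {M} (r : Fin 0 → Fin 0) (c : Term F M 0) → renT r c ≡ c
  renTs-closed-id : ∀ {M} (r : Fin 0 → Fin 0) (cs : List (Term F M 0)) → renTs r cs ≡ cs
  renT-closed-id r (bv ())
  renT-closed-id r (ev x) = refl
  renT-closed-id r (mv X) = refl
  renT-closed-id r (fn f ts) = cong (fn f) (renTs-closed-id r ts)
  renTs-closed-id r [] = refl
  renTs-closed-id r (t ∷ ts) = cong₂ _∷_ (renT-closed-id r t) (renTs-closed-id r ts)

  msub-renT : ∀ {M M' n m} (s : M → Term F M' 0) (r : Fin n → Fin m) (u : Term F M n) →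
              msubT s (renT r u) ≡ renT r (msubT s u)
  msub-renTs : ∀ {M M' n m} (s : M → Term F M' 0) (r : Fin n → Fin m) (us : List (Term F M n)) →
               msubTs s (renTs r us) ≡ renTs r (msubTs s us)
  msub-renT s r (bv i) = refl
  msub-renT s r (ev x) = refl
  msub-renT s r (mv X) = sym (renT-closed _ _ r (s X))
  msub-renT s r (fn f ts) = cong (fn f) (msub-renTs s r ts)
  msub-renTs s r [] = refl
  msub-renTs s r (t ∷ ts) = cong₂ _∷_ (msub-renT s r t) (msub-renTs s r ts)

  msub-subT : ∀ {M M' n m} (s : M → Term F M' 0) (σ : Fin n → Term F M m) (τ : Fin n → Term F M' m) →
              (∀ i → msubT s (σ i) ≡ τ i) → (u : Term F M n) →
              msubT s (subT σ u) ≡ subT τ (msubT s u)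
  msub-subTs : ∀ {M M' n m} (s : M → Term F M' 0) (σ : Fin n → Term F M m) (τ : Fin n → Term F M' m) →
               (∀ i → msubT s (σ i) ≡ τ i) → (us : List (Term F M n)) →
               msubTs s (subTs σ us) ≡ subTs τ (msubTs s us)
  msub-subT s σ τ h (bv i) = h i
  msub-subT s σ τ h (ev x) = refl
  msub-subT s σ τ h (mv X) = sym (subT-closed _ _ τ (s X))
  msub-subT s σ τ h (fn f ts) = cong (fn f) (msub-subTs s σ τ h ts)
  msub-subTs s σ τ h [] = refl
  msub-subTs s σ τ h (t ∷ ts) = cong₂ _∷_ (msub-subT s σ τ h t) (msub-subTs s σ τ h ts)

  msub-lift : ∀ {M M' n m} (s : M → Term F M' 0) (σ : Fin n → Term F M m) (τ : Fin n → Term F M' m) →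
              (∀ i → msubT s (σ i) ≡ τ i) → ∀ i → msubT s (lift σ i) ≡ lift τ i
  msub-lift s σ τ h zero = refl
  msub-lift s σ τ h (suc i) = ≡-trans (msub-renT s suc (σ i)) (cong (renT suc) (h i))

  msub-fuseT : ∀ {M M₁ M' n} (g : M → M₁) (s : M₁ → Term F M' 0) (u : Term F M n) →
               msubT s (msubT (λ X → mv (g X)) u) ≡ msubT (λ X → s (g X)) u
  msub-fuseTs : ∀ {M M₁ M' n} (g : M → M₁) (s : M₁ → Term F M' 0) (us : List (Term F M n)) →
                msubTs s (msubTs (λ X → mv (g X)) us) ≡ msubTs (λ X → s (g X)) us
  msub-fuseT g s (bv i) = refl
  msub-fuseT g s (ev x) = refl
  msub-fuseT g s (mv X) = refl
  msub-fuseT g s (fn f ts) = cong (fn f) (msub-fuseTs g s ts)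
  msub-fuseTs g s [] = refl
  msub-fuseTs g s (t ∷ ts) = cong₂ _∷_ (msub-fuseT g s t) (msub-fuseTs g s ts)

  eigs-renT : ∀ {M n m} (r : Fin n → Fin m) (u : Term F M n) → eigsT (renT r u) ≡ eigsT u
  eigs-renTs : ∀ {M n m} (r : Fin n → Fin m) (us : List (Term F M n)) → eigsTs (renTs r us) ≡ eigsTs us
  eigs-renT r (bv i) = refl
  eigs-renT r (ev x) = refl
  eigs-renT r (mv X) = refl
  eigs-renT r (fn f ts) = eigs-renTs r ts
  eigs-renTs r [] = refl
  eigs-renTs r (t ∷ ts) = cong₂ _++_ (eigs-renT r t) (eigs-renTs r ts)

  module _ {Q : Name → Set} where

    allSubT : ∀ {M n m} (σ : Fin n → Term F M m) → (∀ i → All Q (eigsT (σ i))) →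
              (u : Term F M n) → All Q (eigsT u) → All Q (eigsT (subT σ u))
    allSubTs : ∀ {M n m} (σ : Fin n → Term F M m) → (∀ i → All Q (eigsT (σ i))) →
               (us : List (Term F M n)) → All Q (eigsTs us) → All Q (eigsTs (subTs σ us))
    allSubT σ h (bv i) a = h i
    allSubT σ h (ev x) a = a
    allSubT σ h (mv X) a = []
    allSubT σ h (fn f ts) a = allSubTs σ h ts a
    allSubTs σ h [] a = []
    allSubTs σ h (t ∷ ts) a with ++⁻ (eigsT t) a
    ... | a₁ , a₂ = ++⁺ (allSubT σ h t a₁) (allSubTs σ h ts a₂)

    allLift : ∀ {M n m} (σ : Fin n → Term F M m) → (∀ i → All Q (eigsT (σ i))) →
              ∀ i → All Q (eigsT (lift σ i))
    allLift σ h zero = []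
    allLift σ h (suc i) = subst (All Q) (sym (eigs-renT suc (σ i))) (h i)

    allMsubT : ∀ {M M' n} (s : M → Term F M' 0) → (∀ X → All Q (eigsT (s X))) →
               (u : Term F M n) → All Q (eigsT u) → All Q (eigsT (msubT s u))
    allMsubTs : ∀ {M M' n} (s : M → Term F M' 0) → (∀ X → All Q (eigsT (s X))) →
                (us : List (Term F M n)) → All Q (eigsTs us) → All Q (eigsTs (msubTs s us))
    allMsubT s h (bv i) a = a
    allMsubT s h (ev x) a = a
    allMsubT s h (mv X) a = subst (All Q) (sym (eigs-renT _ (s X))) (h X)
    allMsubT s h (fn f ts) a = allMsubTs s h ts a
    allMsubTs s h [] a = []
    allMsubTs s h (t ∷ ts) a with ++⁻ (eigsT t) a
    ... | a₁ , a₂ = ++⁺ (allMsubT s h t a₁) (allMsubTs s h ts a₂)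

module _ {F P : Set} where

  msub-subF : ∀ {M M' n m} (s : M → Term F M' 0) (σ : Fin n → Term F M m) (τ : Fin n → Term F M' m) →
              (∀ i → msubT s (σ i) ≡ τ i) → (A : Formula F P M n) →
              msubF s (subF σ A) ≡ subF τ (msubF s A)
  msub-subF s σ τ h (atom (pos p ts)) = cong (λ us → atom (pos p us)) (msub-subTs s σ τ h ts)
  msub-subF s σ τ h (atom (neg p ts)) = cong (λ us → atom (neg p us)) (msub-subTs s σ τ h ts)
  msub-subF s σ τ h (A ∧ᶠ B) = cong₂ _∧ᶠ_ (msub-subF s σ τ h A) (msub-subF s σ τ h B)
  msub-subF s σ τ h (A ∨ᶠ B) = cong₂ _∨ᶠ_ (msub-subF s σ τ h A) (msub-subF s σ τ h B)
  msub-subF s σ τ h (∀ᶠ A) = cong ∀ᶠ (msub-subF s (lift σ) (lift τ) (msub-lift s σ τ h) A)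
  msub-subF s σ τ h (∃ᶠ A) = cong ∃ᶠ (msub-subF s (lift σ) (lift τ) (msub-lift s σ τ h) A)

  msub-inst : ∀ {M M' n} (s : M → Term F M' 0) (A : Formula F P M (ℕ.suc n)) (t : Term F M n) →
              msubF s (A [ t ]) ≡ (msubF s A) [ msubT s t ]
  msub-inst s A t = msub-subF s _ _ (λ { zero → refl ; (suc i) → refl }) A

  msub-fuseF : ∀ {M M₁ M' n} (g : M → M₁) (s : M₁ → Term F M' 0) (A : Formula F P M n) →
               msubF s (msubF (λ X → mv (g X)) A) ≡ msubF (λ X → s (g X)) A
  msub-fuseF g s (atom (pos p ts)) = cong (λ us → atom (pos p us)) (msub-fuseTs g s ts)
  msub-fuseF g s (atom (neg p ts)) = cong (λ us → atom (neg p us)) (msub-fuseTs g s ts)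
  msub-fuseF g s (A ∧ᶠ B) = cong₂ _∧ᶠ_ (msub-fuseF g s A) (msub-fuseF g s B)
  msub-fuseF g s (A ∨ᶠ B) = cong₂ _∨ᶠ_ (msub-fuseF g s A) (msub-fuseF g s B)
  msub-fuseF g s (∀ᶠ A) = cong ∀ᶠ (msub-fuseF g s A)
  msub-fuseF g s (∃ᶠ A) = cong ∃ᶠ (msub-fuseF g s A)

  map-msub-fuse : ∀ {M M₁ M'} (g : M → M₁) (s : M₁ → Term F M' 0) (Δ : List (Formula F P M 0)) →
                  map (msubF s) (map (msubF (λ X → mv (g X))) Δ) ≡ map (msubF (λ X → s (g X))) Δ
  map-msub-fuse g s [] = refl
  map-msub-fuse g s (A ∷ Δ) = cong₂ _∷_ (msub-fuseF g s A) (map-msub-fuse g s Δ)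

  module _ {Q : Name → Set} where

    allSubF : ∀ {M n m} (σ : Fin n → Term F M m) → (∀ i → All Q (eigsT (σ i))) →
              (A : Formula F P M n) → All Q (eigsF A) → All Q (eigsF (subF σ A))
    allSubF σ h (atom (pos p ts)) a = allSubTs σ h ts a
    allSubF σ h (atom (neg p ts)) a = allSubTs σ h ts a
    allSubF σ h (A ∧ᶠ B) a with ++⁻ (eigsF A) a
    ... | a₁ , a₂ = ++⁺ (allSubF σ h A a₁) (allSubF σ h B a₂)
    allSubF σ h (A ∨ᶠ B) a with ++⁻ (eigsF A) a
    ... | a₁ , a₂ = ++⁺ (allSubF σ h A a₁) (allSubF σ h B a₂)
    allSubF σ h (∀ᶠ A) a = allSubF (lift σ) (allLift σ h) A a
    allSubF σ h (∃ᶠ A) a = allSubF (lift σ) (allLift σ h) A a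

    allInst : ∀ {M n} (A : Formula F P M (ℕ.suc n)) (t : Term F M n) →
              All Q (eigsT t) → All Q (eigsF A) → All Q (eigsF (A [ t ]))
    allInst A t ht = allSubF _ (λ { zero → ht ; (suc i) → [] }) A

    allMsubF : ∀ {M M' n} (s : M → Term F M' 0) → (∀ X → All Q (eigsT (s X))) →
               (A : Formula F P M n) → All Q (eigsF A) → All Q (eigsF (msubF s A))
    allMsubF s h (atom (pos p ts)) a = allMsubTs s h ts a
    allMsubF s h (atom (neg p ts)) a = allMsubTs s h ts a
    allMsubF s h (A ∧ᶠ B) a with ++⁻ (eigsF A) a
    ... | a₁ , a₂ = ++⁺ (allMsubF s h A a₁) (allMsubF s h B a₂)
    allMsubF s h (A ∨ᶠ B) a with ++⁻ (eigsF A) a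
    ... | a₁ , a₂ = ++⁺ (allMsubF s h A a₁) (allMsubF s h B a₂)
    allMsubF s h (∀ᶠ A) a = allMsubF s h A a
    allMsubF s h (∃ᶠ A) a = allMsubF s h A a

  lits-msub : ∀ {M M'} (s : M → Term F M' 0) (Γ : List (Formula F P M 0)) →
              lits (map (msubF s) Γ) ≡ map (msubL s) (lits Γ)
  lits-msub s [] = refl
  lits-msub s (atom l ∷ Γ) = cong (msubL s l ∷_) (lits-msub s Γ)
  lits-msub s ((A ∧ᶠ B) ∷ Γ) = lits-msub s Γ
  lits-msub s ((A ∨ᶠ B) ∷ Γ) = lits-msub s Γ
  lits-msub s (∀ᶠ A ∷ Γ) = lits-msub s Γ
  lits-msub s (∃ᶠ A ∷ Γ) = lits-msub s Γ

  lits-sound : ∀ {M} {l : Lit F P M 0} (Γ : List (Formula F P M 0)) → l ∈ lits Γ → atom l ∈ Γ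
  lits-sound (atom l ∷ Γ) (here refl) = here refl
  lits-sound (atom l ∷ Γ) (there m) = there (lits-sound Γ m)
  lits-sound ((A ∧ᶠ B) ∷ Γ) m = there (lits-sound Γ m)
  lits-sound ((A ∨ᶠ B) ∷ Γ) m = there (lits-sound Γ m)
  lits-sound (∀ᶠ A ∷ Γ) m = there (lits-sound Γ m)
  lits-sound (∃ᶠ A ∷ Γ) m = there (lits-sound Γ m)

  lits-complete : ∀ {M} {l : Lit F P M 0} (Γ : List (Formula F P M 0)) → atom l ∈ Γ → l ∈ lits Γ
  lits-complete (atom l ∷ Γ) (here refl) = here refl
  lits-complete (atom l ∷ Γ) (there m) = there (lits-complete Γ m)
  lits-complete ((A ∧ᶠ B) ∷ Γ) (here ())
  lits-complete ((A ∧ᶠ B) ∷ Γ) (there m) = lits-complete Γ m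
  lits-complete ((A ∨ᶠ B) ∷ Γ) (here ())
  lits-complete ((A ∨ᶠ B) ∷ Γ) (there m) = lits-complete Γ m
  lits-complete (∀ᶠ A ∷ Γ) (here ())
  lits-complete (∀ᶠ A ∷ Γ) (there m) = lits-complete Γ m
  lits-complete (∃ᶠ A ∷ Γ) (here ())
  lits-complete (∃ᶠ A ∷ Γ) (there m) = lits-complete Γ m

  lits-set : ∀ {M} {Γ Γ' : List (Formula F P M 0)} → Γ ↭ Γ' → lits Γ ∼[ set ] lits Γ'
  lits-set {Γ = Γ} {Γ'} p =
    mk⇔ (λ m → lits-complete Γ' (∈-resp-↭ p (lits-sound Γ m)))
        (λ m → lits-complete Γ (∈-resp-↭ (↭-sym p) (lits-sound Γ' m)))

  lits-scope : ∀ d (Γ : List (Formula F P (MV d) 0)) → All (FormOfDom d) Γ → All (LitOfDom d) (lits Γ)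
  lits-scope d [] [] = []
  lits-scope d (atom l ∷ Γ) (a ∷ sc) = a ∷ lits-scope d Γ sc
  lits-scope d ((A ∧ᶠ B) ∷ Γ) (a ∷ sc) = lits-scope d Γ sc
  lits-scope d ((A ∨ᶠ B) ∷ Γ) (a ∷ sc) = lits-scope d Γ sc
  lits-scope d (∀ᶠ A ∷ Γ) (a ∷ sc) = lits-scope d Γ sc
  lits-scope d (∃ᶠ A ∷ Γ) (a ∷ sc) = lits-scope d Γ sc

  inv∧ : ∀ {M M'} (s : M → Term F M' 0) (x : Formula F P M 0) {A' B'} → msubF s x ≡ A' ∧ᶠ B' →
         Σ _ λ A → Σ _ λ B → (x ≡ A ∧ᶠ B) × (msubF s A ≡ A') × (msubF s B ≡ B')
  inv∧ s (atom (pos _ _)) ()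
  inv∧ s (atom (neg _ _)) ()
  inv∧ s (A ∧ᶠ B) refl = A , B , refl , refl , refl
  inv∧ s (A ∨ᶠ B) ()
  inv∧ s (∀ᶠ A) ()
  inv∧ s (∃ᶠ A) ()

  inv∨ : ∀ {M M'} (s : M → Term F M' 0) (x : Formula F P M 0) {A' B'} → msubF s x ≡ A' ∨ᶠ B' →
         Σ _ λ A → Σ _ λ B → (x ≡ A ∨ᶠ B) × (msubF s A ≡ A') × (msubF s B ≡ B')
  inv∨ s (atom (pos _ _)) ()
  inv∨ s (atom (neg _ _)) ()
  inv∨ s (A ∧ᶠ B) ()
  inv∨ s (A ∨ᶠ B) refl = A , B , refl , refl , refl
  inv∨ s (∀ᶠ A) ()
  inv∨ s (∃ᶠ A) ()

  inv∀ : ∀ {M M'} (s : M → Term F M' 0) (x : Formula F P M 0) {A'} → msubF s x ≡ ∀ᶠ A' →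
         Σ _ λ A → (x ≡ ∀ᶠ A) × (msubF s A ≡ A')
  inv∀ s (atom (pos _ _)) ()
  inv∀ s (atom (neg _ _)) ()
  inv∀ s (A ∧ᶠ B) ()
  inv∀ s (A ∨ᶠ B) ()
  inv∀ s (∀ᶠ A) refl = A , refl , refl
  inv∀ s (∃ᶠ A) ()

  inv∃ : ∀ {M M'} (s : M → Term F M' 0) (x : Formula F P M 0) {A'} → msubF s x ≡ ∃ᶠ A' →
         Σ _ λ A → (x ≡ ∃ᶠ A) × (msubF s A ≡ A')
  inv∃ s (atom (pos _ _)) ()
  inv∃ s (atom (neg _ _)) ()
  inv∃ s (A ∧ᶠ B) ()
  inv∃ s (A ∨ᶠ B) ()
  inv∃ s (∀ᶠ A) ()
  inv∃ s (∃ᶠ A) refl = A , refl , refl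

map-inv : ∀ {A B : Set} (f : A → B) (Γ : List A) {y Δ'} → map f Γ ↭ y ∷ Δ' →
          Σ A λ x → Σ (List A) λ Δ → (Γ ↭ x ∷ Δ) × (f x ≡ y) × (map f Δ ↭ Δ')
map-inv f Γ {y} {Δ'} q with ∈-map⁻ f (∈-resp-↭ (↭-sym q) (here refl))
... | x , x∈Γ , refl with ∈-∃++ x∈Γ
... | as , bs , refl =
  x , as ++ bs , shift x as bs , refl ,
  drop-∷ (↭-trans (↭-sym (map⁺ f (shift x as bs))) q)

module Main (S : Setup) where
  open Setup S
  open Systems S

  _⊆ᵉ_ : Dom → Dom → Set
  d ⊆ᵉ d' = ∀ x → Declared x d → Declared x d'

  -- Two domains declaring the same eigenvariables (they may differ in their
  -- meta-variables, which LK1 never mentions).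
  _≈ᵉ_ : Dom → Dom → Set
  d ≈ᵉ d' = (d ⊆ᵉ d') × (d' ⊆ᵉ d)

  ≈ᵉ-refl : ∀ {d} → d ≈ᵉ d
  ≈ᵉ-refl = (λ _ m → m) , (λ _ m → m)

  ≈ᵉ-sym : ∀ {d d'} → d ≈ᵉ d' → d' ≈ᵉ d
  ≈ᵉ-sym (e₁ , e₂) = e₂ , e₁

  ≈ᵉ-meta : ∀ {d d'} → d ≈ᵉ d' → d ≈ᵉ (meta ∷ d')
  ≈ᵉ-meta (e₁ , e₂) = (λ x m → there (e₁ x m)) , λ { x (here ()) ; x (there m) → e₂ x m }

  ≈ᵉ-eig : ∀ {d d'} x → d ≈ᵉ d' → (eig x ∷ d) ≈ᵉ (eig x ∷ d')
  ≈ᵉ-eig x (e₁ , e₂) = extend e₁ , extend e₂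
    where
      extend : ∀ {d d'} → d ⊆ᵉ d' → (eig x ∷ d) ⊆ᵉ (eig x ∷ d')
      extend e y (here p) = here p
      extend e y (there m) = there (e y m)

  transferGTerm : ∀ {d d'} → d ⊆ᵉ d' → GTerm Fun d → GTerm Fun d'
  transferGTerm e (t , a) = t , All.map (e _) a

  transfer : ∀ {d d' Γ} → d ≈ᵉ d' → LK1 d Γ → LK1 d' Γ
  transfer e (lk-ax h) = lk-ax h
  transfer e (lk-∧ p D₁ D₂) = lk-∧ p (transfer e D₁) (transfer e D₂)
  transfer e (lk-∨ p D) = lk-∨ p (transfer e D)
  transfer e (lk-∃ p t D) = lk-∃ p (transferGTerm (proj₁ e) t) (transfer e D)
  transfer (e₁ , e₂) (lk-∀ p x x∉d D) =
    lk-∀ p x (λ m → x∉d (e₂ _ m)) (transfer (≈ᵉ-eig x (e₁ , e₂)) D)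

  ∃-premise : ∀ d (A : Formula Fun Pred (MV d) 1) (Δ : List (Form d)) → List (Form (meta ∷ d))
  ∃-premise d A Δ = (wkM d A [ mv nothing ]) ∷ wkM d (∃ᶠ A) ∷ map (wkM d) Δ

  inst-∃-premise : ∀ d (ρ : Inst' d) (t : GTerm Fun d) (A : Formula Fun Pred (MV d) 1) (Δ : List (Form d)) →
                   map (instF (meta ∷ d) (ρ , t)) (∃-premise d A Δ)
                   ≡ (msubF (lookupI d ρ) A [ proj₁ t ]) ∷ instF d ρ (∃ᶠ A) ∷ map (instF d ρ) Δ
  inst-∃-premise d ρ t A Δ = cong₂ _∷_ instance-eq (cong₂ _∷_ (msub-fuseF just s (∃ᶠ A)) (map-msub-fuse just s Δ))
    where
      s = lookupI (meta ∷ d) (ρ , t)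
      instance-eq : instF (meta ∷ d) (ρ , t) (wkM d A [ mv nothing ]) ≡ msubF (lookupI d ρ) A [ proj₁ t ]
      instance-eq = ≡-trans (msub-inst s (wkM d A) (mv nothing))
                            (cong₂ _[_] (msub-fuseF just s A) (renT-closed-id _ (proj₁ t)))

  inst-∀-premise : ∀ d (ρ : Inst' d) x (A : Formula Fun Pred (MV d) 1) (Δ : List (Form d)) →
                   map (instF d ρ) (A [ ev x ] ∷ Δ) ≡ (msubF (lookupI d ρ) A [ ev x ]) ∷ map (instF d ρ) Δ
  inst-∀-premise d ρ x A Δ = cong (_∷ map (instF d ρ) Δ) (msub-inst (lookupI d ρ) A (ev x))

  scope-∧ : ∀ {d} {Γ Δ : List (Form d)} {A B : Form d} → All (FormOfDom d) Γ → Γ ↭ (A ∧ᶠ B) ∷ Δ →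
            All (FormOfDom d) (A ∷ Δ) × All (FormOfDom d) (B ∷ Δ)
  scope-∧ {A = A} sc p with All-resp-↭ p sc
  ... | a ∷ aΔ with ++⁻ (eigsF A) a
  ... | aA , aB = aA ∷ aΔ , aB ∷ aΔ

  scope-∨ : ∀ {d} {Γ Δ : List (Form d)} {A B : Form d} → All (FormOfDom d) Γ → Γ ↭ (A ∨ᶠ B) ∷ Δ →
            All (FormOfDom d) (A ∷ B ∷ Δ)
  scope-∨ {A = A} sc p with All-resp-↭ p sc
  ... | a ∷ aΔ with ++⁻ (eigsF A) a
  ... | aA , aB = aA ∷ aB ∷ aΔ

  scope-∃ : ∀ {d} {Γ Δ : List (Form d)} {A : Formula Fun Pred (MV d) 1} → All (FormOfDom d) Γ → Γ ↭ ∃ᶠ A ∷ Δ →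
            All (FormOfDom (meta ∷ d)) (∃-premise d A Δ)
  scope-∃ {d} {A = A} sc p with All-resp-↭ p sc
  ... | a ∷ aΔ =
    allInst (wkM d A) (mv nothing) [] (weaken A a) ∷ weaken A a ∷ All.map⁺ (All.map (λ {B} → weaken B) aΔ)
    where
      weaken : ∀ {n} (B : Formula Fun Pred (MV d) n) → All (λ y → Declared y d) (eigsF B) →
               All (λ y → Declared y (meta ∷ d)) (eigsF (wkM d B))
      weaken B b = allMsubF _ (λ X → []) B (All.map there b)

  scope-∀ : ∀ {d} {Γ Δ : List (Form d)} {A : Formula Fun Pred (MV d) 1} x → All (FormOfDom d) Γ → Γ ↭ ∀ᶠ A ∷ Δ →
            All (FormOfDom (eig x ∷ d)) (A [ ev x ] ∷ Δ)
  scope-∀ {A = A} x sc p with All-resp-↭ p sc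
  ... | a ∷ aΔ = allInst A (ev x) (here refl ∷ []) (All.map there a) ∷ All.map (All.map there) aΔ

  soundness : ∀ {d Γ σ} → DI d Γ σ → All (FormOfDom d) Γ → (ρ : Inst' d) → ε d ρ σ →
              LK1 d (map (instF d ρ) Γ)
  soundness {d} {Γ} {σ} (di-ax h) sc ρ e =
    lk-ax (subst ⊨ (sym (lits-msub (lookupI d ρ) Γ))
      (Equivalence.from (ax-Rel d (lits Γ) (lits-scope d Γ sc) ρ) (σ , h , e)))
  soundness {d} (di-∧ {σ = σ} {σ' = σ'} p D₁ D₂) sc ρ e =
    let sc₁ , sc₂ = scope-∧ sc p
        e₁ , e₂ = Equivalence.from (ax-Meet d σ σ' ρ) e
    in lk-∧ (map⁺ _ p) (soundness D₁ sc₁ ρ e₁) (soundness D₂ sc₂ ρ e₂)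
  soundness (di-∨ p D) sc ρ e = lk-∨ (map⁺ _ p) (soundness D (scope-∨ sc p) ρ e)
  soundness {d} (di-∃ {Δ = Δ} {A = A} {σ = σ} p D) sc ρ e =
    lk-∃ (map⁺ _ p) t (transfer (≈ᵉ-sym (≈ᵉ-meta ≈ᵉ-refl))
      (subst (LK1 (meta ∷ d)) (inst-∃-premise d ρ t A Δ)
        (soundness D (scope-∃ sc p) (ρ , t) (ax-Witness d σ ρ e))))
    where t = W d σ ρ
  soundness {d} (di-∀ {Δ = Δ} {A = A} p x x∉d D) sc ρ e =
    lk-∀ (map⁺ _ p) x x∉d
      (subst (LK1 (eig x ∷ d)) (inst-∀-premise d ρ x A Δ) (soundness D (scope-∀ x sc p) ρ e))

  -- Part (2): completeness of DI, for an LK1 derivation of domain d' with the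
  -- same eigenvariables as d (the ∃-rule keeps the LK1 domain but extends the
  -- DI domain by a meta-variable).
  completeness : ∀ {d' Γ'} → LK1 d' Γ' → ∀ {d} → d' ≈ᵉ d → (ρ : Inst' d) (Γ : List (Form d)) →
                 All (FormOfDom d) Γ → map (instF d ρ) Γ ↭ Γ' → Σ (Ψ d) (λ σ → DI d Γ σ × ε d ρ σ)
  completeness (lk-ax h) {d} e ρ Γ sc q
    with Equivalence.to (ax-Rel d (lits Γ) (lits-scope d Γ sc) ρ)
           (subst ⊨ (lits-msub (lookupI d ρ) Γ) (⊨-set (lits-set (↭-sym q)) h))
  ... | σ , h' , ε-σ = σ , di-ax h' , ε-σ
  completeness (lk-∧ p D₁ D₂) {d} e ρ Γ sc q with map-inv (instF d ρ) Γ (↭-trans q p)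
  ... | x , Δ , r , fx , m with inv∧ (lookupI d ρ) x fx
  ... | A , B , refl , refl , refl =
    let sc₁ , sc₂ = scope-∧ sc r
        σ₁ , D₁' , ε₁ = completeness D₁ e ρ (A ∷ Δ) sc₁ (prep _ m)
        σ₂ , D₂' , ε₂ = completeness D₂ e ρ (B ∷ Δ) sc₂ (prep _ m)
    in meet d σ₁ σ₂ , di-∧ r D₁' D₂' , Equivalence.to (ax-Meet d σ₁ σ₂ ρ) (ε₁ , ε₂)
  completeness (lk-∨ p D) {d} e ρ Γ sc q with map-inv (instF d ρ) Γ (↭-trans q p)
  ... | x , Δ , r , fx , m with inv∨ (lookupI d ρ) x fx
  ... | A , B , refl , refl , refl =
    let σ , D' , ε-σ = completeness D e ρ (A ∷ B ∷ Δ) (scope-∨ sc r) (prep _ (prep _ m))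
    in σ , di-∨ r D' , ε-σ
  completeness (lk-∃ p t D) {d} e ρ Γ sc q with map-inv (instF d ρ) Γ (↭-trans q p)
  ... | x , Δ , r , fx , m with inv∃ (lookupI d ρ) x fx
  ... | A , refl , refl =
    let t' = transferGTerm (proj₁ e) t
        σ , D' , ε-σ = completeness D (≈ᵉ-meta e) (ρ , t') (∃-premise d A Δ) (scope-∃ sc r)
                         (↭-trans (↭-reflexive (inst-∃-premise d ρ t' A Δ)) (prep _ (prep _ m)))
    in proj d σ , di-∃ r D' , ax-Proj d σ t' ρ ε-σ
  completeness (lk-∀ p x x∉d' D) {d} e ρ Γ sc q with map-inv (instF d ρ) Γ (↭-trans q p)
  ... | y , Δ , r , fy , m with inv∀ (lookupI d ρ) y fy
  ... | A , refl , refl =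
    let σ , D' , ε-σ = completeness D (≈ᵉ-eig x e) ρ (A [ ev x ] ∷ Δ) (scope-∀ x sc r)
                         (↭-trans (↭-reflexive (inst-∀-premise d ρ x A Δ)) (prep _ m))
    in σ , di-∀ r x (λ n → x∉d' (proj₂ e _ n)) D' , ε-σ

theorem1 : (S : Setup) → let open Systems S in
    (d : Dom) → WfDom d → (Γ : List (Form d)) → All (FormOfDom d) Γ →
    ((σ : Ψ d) → DI d Γ σ → (ρ : Inst' d) → ε d ρ σ →
       LK1 d (map (instF d ρ) Γ))
    × ((ρ : Inst' d) → LK1 d (map (instF d ρ) Γ) →
       Σ (Ψ d) (λ σ → DI d Γ σ × ε d ρ σ))
theorem1 S d _ Γ sc =
  (λ σ D ρ e → soundness D sc ρ e) ,
  (λ ρ L → completeness L ≈ᵉ-refl ρ Γ sc ↭-refl)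
  where open Main S
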